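{- Let $w$ be a repeat in a string $S$ over alphabet $\Sigma$, and let $(\alpha,\beta)\in\Phi_S(w)$. Then for every character $\beta'\neq\beta$, $(\alpha,\beta')\notin\Phi_S(w)$. Similarly, for every character $\alpha'\neq\alpha$, $(\alpha',\beta)\notin\Phi_S(w)$.
   Context: For strings $w,S$, $\mathrm{occ}_S(w)$ denotes the number of starting positions $i$ with $S[i..i+|w|-1]=w$. A repeat in $S$ is a string $w$ with $\mathrm{occ}_S(w)\ge 2$. For a repeat $w$ of $S$, $\Phi_S(w) = \{(\alpha,\beta)\in\Sigma\times\Sigma \mid \mathrm{occ}_S(\alpha w\beta)=\mathrm{occ}_S(\alpha w)=\mathrm{occ}_S(w\beta)=1\}$. -}

module Defs where

open import Data.Nat using (ℕ; zero; suc; _+_; _≥_)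
open import Data.List using (List; []; _∷_; _++_; [_])
open import Relation.Binary.Definitions using (DecidableEquality)
open import Relation.Nullary using (yes; no)
open import Data.Product using (_×_)
open import Relation.Binary.PropositionalEquality using (_≡_)

module _ {Σ : Set} (_≟_ : DecidableEquality Σ) where

  prefix? : List Σ → List Σ → ℕ
  prefix? [] _ = 1
  prefix? (_ ∷ _) [] = 0
  prefix? (a ∷ w) (b ∷ s) with a ≟ b
  ... | yes _ = prefix? w s
  ... | no _ = 0

  -- occ S w : number of starting positions i (0 ≤ i ≤ |S|-|w|) with S[i..i+|w|-1] = w,
  -- i.e. number of suffixes of S (including the empty one) having w as a prefix
  occ : List Σ → List Σ → ℕ
  occ [] w = prefix? w []
  occ (c ∷ S) w = prefix? w (c ∷ S) + occ S w

  IsRepeat : List Σ → List Σ → Set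
  IsRepeat S w = occ S w ≥ 2

  InΦ : List Σ → List Σ → Σ → Σ → Set
  InΦ S w α β =
    (occ S (α ∷ (w ++ [ β ])) ≡ 1) × (occ S (α ∷ w) ≡ 1) × (occ S (w ++ [ β ]) ≡ 1)

-- Occurrences of u β and of u β′ (β ≢ β′) are distinct occurrences of u, so
-- occ(u β) + occ(u β′) ≤ occ(u); likewise an occurrence of α v or α′ v yields
-- one of v a position later, so occ(α v) + occ(α′ v) ≤ occ(v).  For (α, β) and
-- (α, β′) both in Φ_S(w) the first bound with u = α w reads 1 + 1 ≤ 1; for
-- (α, β) and (α′, β) the second with v = w β does.
module Submission where

open import Defs
open import Data.List using (List; []; _∷_; _++_; [_])
open import Data.Nat using (ℕ; _+_; _≤_; z≤n; s≤s)
open import Data.Nat.Properties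
  using (≤-refl; ≤-trans; ≤-reflexive; +-mono-≤; +-identityʳ; m≤n+m; +-commutativeSemigroup)
open import Algebra.Properties.CommutativeSemigroup +-commutativeSemigroup using (interchange)
open import Data.Product using (_×_; _,_)
open import Data.Empty using (⊥-elim)
open import Relation.Nullary using (¬_; yes; no)
open import Relation.Binary.PropositionalEquality using (_≡_; _≢_; refl; sym)
open import Relation.Binary.Definitions using (DecidableEquality)

module _ {Σ : Set} (_≟_ : DecidableEquality Σ) where

  private
    prefix : List Σ → List Σ → ℕ
    prefix = prefix? _≟_

    occurrences : List Σ → List Σ → ℕ
    occurrences = occ _≟_

  prefix?-snoc-disjoint : ∀ {b b′} → b ≢ b′ → (u s : List Σ) →
    prefix (u ++ [ b ]) s + prefix (u ++ [ b′ ]) s ≤ prefix u s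
  prefix?-snoc-disjoint b≢b′ [] [] = z≤n
  prefix?-snoc-disjoint {b} {b′} b≢b′ [] (c ∷ s) with b ≟ c | b′ ≟ c
  ... | yes refl | yes refl = ⊥-elim (b≢b′ refl)
  ... | yes _    | no _     = s≤s z≤n
  ... | no _     | yes _    = s≤s z≤n
  ... | no _     | no _     = z≤n
  prefix?-snoc-disjoint b≢b′ (a ∷ u) [] = z≤n
  prefix?-snoc-disjoint b≢b′ (a ∷ u) (c ∷ s) with a ≟ c
  ... | yes _ = prefix?-snoc-disjoint b≢b′ u s
  ... | no _  = z≤n

  prefix?-cons-disjoint : ∀ {a a′} → a ≢ a′ → (v : List Σ) (c : Σ) (s : List Σ) →
    prefix (a ∷ v) (c ∷ s) + prefix (a′ ∷ v) (c ∷ s) ≤ prefix v s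
  prefix?-cons-disjoint {a} {a′} a≢a′ v c s with a ≟ c | a′ ≟ c
  ... | yes refl | yes refl = ⊥-elim (a≢a′ refl)
  ... | yes _    | no _     = ≤-reflexive (+-identityʳ (prefix v s))
  ... | no _     | yes _    = ≤-refl
  ... | no _     | no _     = z≤n

  occ-+-≤ : ∀ {x y z} → (∀ s → prefix x s + prefix y s ≤ prefix z s) →
    (S : List Σ) → occurrences S x + occurrences S y ≤ occurrences S z
  occ-+-≤ pointwise [] = pointwise []
  occ-+-≤ {x} {y} pointwise (c ∷ S) = ≤-trans
    (≤-reflexive (interchange (prefix x (c ∷ S)) (occurrences S x)
                              (prefix y (c ∷ S)) (occurrences S y)))
    (+-mono-≤ (pointwise (c ∷ S)) (occ-+-≤ pointwise S))

  occ-snoc-disjoint : ∀ {b b′} → b ≢ b′ → (u S : List Σ) →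
    occurrences S (u ++ [ b ]) + occurrences S (u ++ [ b′ ]) ≤ occurrences S u
  occ-snoc-disjoint b≢b′ u = occ-+-≤ (prefix?-snoc-disjoint b≢b′ u)

  occ-cons-disjoint : ∀ {a a′} → a ≢ a′ → (v S : List Σ) →
    occurrences S (a ∷ v) + occurrences S (a′ ∷ v) ≤ occurrences S v
  occ-cons-disjoint a≢a′ v [] = z≤n
  occ-cons-disjoint {a} {a′} a≢a′ v (c ∷ S) =
    ≤-trans (shifted c S) (m≤n+m (occurrences S v) (prefix v (c ∷ S)))
    where
    shifted : ∀ c S →
      occurrences (c ∷ S) (a ∷ v) + occurrences (c ∷ S) (a′ ∷ v) ≤ occurrences S v
    shifted c [] = ≤-trans
      (≤-reflexive (interchange (prefix (a ∷ v) [ c ]) 0 (prefix (a′ ∷ v) [ c ]) 0))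
      (≤-trans (+-mono-≤ (prefix?-cons-disjoint a≢a′ v c []) z≤n)
               (≤-reflexive (+-identityʳ (prefix v []))))
    shifted c (d ∷ S) = ≤-trans
      (≤-reflexive (interchange (prefix (a ∷ v) (c ∷ d ∷ S)) (occurrences (d ∷ S) (a ∷ v))
                                (prefix (a′ ∷ v) (c ∷ d ∷ S)) (occurrences (d ∷ S) (a′ ∷ v))))
      (+-mono-≤ (prefix?-cons-disjoint a≢a′ v c (d ∷ S)) (shifted d S))

once+once≰once : ∀ {x y z : ℕ} → x ≡ 1 → y ≡ 1 → z ≡ 1 → ¬ x + y ≤ z
once+once≰once refl refl refl (s≤s ())

lemma3 : {Σ : Set} (_≟_ : DecidableEquality Σ) (S w : List Σ) →
    IsRepeat _≟_ S w → (α β : Σ) → InΦ _≟_ S w α β →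
    ((β′ : Σ) → ¬ (β′ ≡ β) → ¬ InΦ _≟_ S w α β′) ×
    ((α′ : Σ) → ¬ (α′ ≡ α) → ¬ InΦ _≟_ S w α′ β)
lemma3 _≟_ S w _ α β (αwβ-once , αw-once , wβ-once) =
  (λ β′ β′≢β (αwβ′-once , _ , _) →
     once+once≰once αwβ-once αwβ′-once αw-once
       (occ-snoc-disjoint _≟_ (λ β≡β′ → β′≢β (sym β≡β′)) (α ∷ w) S)) ,
  (λ α′ α′≢α (α′wβ-once , _ , _) →
     once+once≰once αwβ-once α′wβ-once wβ-once
       (occ-cons-disjoint _≟_ (λ α≡α′ → α′≢α (sym α≡α′)) (w ++ [ β ]) S))
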